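{- Let $T_1$ be an $n$-node forest, and for every $i \ge 2$ let $T_i$ be a forest obtained from $T_{i-1}$ by removing all its maximal pendant paths and some of its maximal internal paths. Then $T_i$ has fewer than $n/2^i$ nodes of degree at least 3. In particular, $T_{\lceil \log n \rceil + 1}$ has no nodes.
   Context: Here $\log$ is base 2. In a forest $T$, a path $v_1,\dots,v_k$ is binary if $\deg_T(v_j)\le 2$ for all $j$; it is pendant if it is binary and $\deg_T(v_1)=1$ or $\deg_T(v_k)=1$ (an isolated vertex is also considered a pendant path); it is internal if $\deg_T(v_j)=2$ for all $j$. A binary/pendant/internal path is maximal if it cannot be enlarged by adding a vertex outside the path to it (keeping the same property). Removing a path means deleting its vertices (and incident edges). -}

module Defs where

open import Data.Nat using (ℕ; zero; suc; _+_; _≤_)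
open import Data.Bool using (Bool; true; false; _∧_; if_then_else_)
open import Data.Fin using (Fin)
open import Data.List using (List; []; _∷_; _++_; _∷ʳ_; map; allFin)
open import Data.Nat.ListAction using (sum)
open import Data.List.Relation.Unary.All using (All)
open import Data.List.Relation.Unary.Any using (Any)
open import Data.List.Relation.Unary.Unique.Propositional using (Unique)
open import Data.List.Relation.Unary.Linked using (Linked)
open import Data.List.Membership.Propositional using (_∈_; _∉_)
open import Data.Product using (Σ; ∃; _×_)
open import Data.Sum using (_⊎_)
open import Relation.Nullary using (¬_)
open import Relation.Binary.PropositionalEquality using (_≡_)

record Forest (n : ℕ) : Set where
  field
    adj     : Fin n → Fin n → Bool
    adj-sym : ∀ u v → adj u v ≡ adj v u
    irrefl  : ∀ v → adj v v ≡ false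
    -- no cycle v, m, mid..., w, v with at least 3 distinct vertices
    acyclic : ∀ v m mid w →
              Unique (v ∷ m ∷ mid ++ w ∷ []) →
              Linked (λ x y → adj x y ≡ true) (v ∷ m ∷ mid ++ w ∷ []) →
              adj w v ≡ false
open Forest public

count : ∀ {n} → (Fin n → Bool) → ℕ
count {n} f = sum (map (λ u → if f u then 1 else 0) (allFin n))

-- Subforests (obtained by deleting vertices) are induced subgraphs,
-- given by their vertex set S : Fin n → Bool.
module _ {n : ℕ} (F : Forest n) (S : Fin n → Bool) where

  deg : Fin n → ℕ
  deg v = count (λ u → S u ∧ adj F v u)

  IsPath : List (Fin n) → Set
  IsPath ps = (ps ≡ [] → Data.Empty.⊥) × Unique ps × All (λ v → S v ≡ true) ps
            × Linked (λ x y → adj F x y ≡ true) ps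
    where import Data.Empty

  BinaryPath : List (Fin n) → Set
  BinaryPath ps = IsPath ps × All (λ v → deg v ≤ 2) ps

  PendantPath : List (Fin n) → Set
  PendantPath ps = BinaryPath ps ×
    ((Σ (Fin n) λ v → Σ (List (Fin n)) λ rest → ps ≡ v ∷ rest × deg v ≡ 1)
     ⊎ (Σ (Fin n) λ v → Σ (List (Fin n)) λ rest → ps ≡ rest ∷ʳ v × deg v ≡ 1)
     ⊎ (Σ (Fin n) λ v → ps ≡ v ∷ [] × deg v ≡ 0))

  InternalPath : List (Fin n) → Set
  InternalPath ps = IsPath ps × All (λ v → deg v ≡ 2) ps

  Maximal : (List (Fin n) → Set) → List (Fin n) → Set
  Maximal P ps = P ps × (∀ w → w ∉ ps → ¬ P (w ∷ ps) × ¬ P (ps ∷ʳ w))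

  Step : (Fin n → Bool) → Set
  Step S' = Σ (List (List (Fin n))) λ Qs →
    All (Maximal InternalPath) Qs ×
    (∀ v → (S' v ≡ true →
              S v ≡ true
              × ¬ (Σ (List (Fin n)) λ ps → Maximal PendantPath ps × v ∈ ps)
              × ¬ Any (v ∈_) Qs)
         × (S v ≡ true
              × ¬ (Σ (List (Fin n)) λ ps → Maximal PendantPath ps × v ∈ ps)
              × ¬ Any (v ∈_) Qs → S' v ≡ true))

  deg≥3-count : ℕ
  deg≥3-count = count (λ v → S v ∧ (3 Data.Nat.≤ᵇ deg v))

-- Let b(S) and ℓ(S) be the numbers of vertices of degree ≥ 3 and ≤ 1 in a subforest S.
-- Since a forest has fewer edges than vertices, summing degrees gives b + 2 ≤ ℓ whenever
-- b ≥ 1, and trivially b + ℓ ≤ n. In a step S ↦ S′ every vertex of degree ≤ 1 lies on a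
-- maximal pendant path and is removed, and a surviving vertex of degree 2 keeps both
-- neighbours, because a maximal pendant (internal) path cannot end next to a vertex of
-- degree ≤ 2 (= 2). So every vertex of degree ≤ 1 in S′ had degree ≥ 3 in S, whence
-- b(S′) + ℓ(S′) ≤ b(S) and b(S′) ≤ b(S) / 2. Hence b(T_i) 2^i < n, and once 2^i ≥ n there
-- is no vertex of degree ≥ 3 left: T_i is a union of maximal pendant paths, all removed next.
module Submission where

open import Defs
open import Data.Nat
  using (ℕ; zero; suc; _+_; _*_; _^_; _≤_; _<_; z≤n; s≤s; z<s; _≤ᵇ_; _≤?_; ⌊_/2⌋; ⌈_/2⌉)
open import Data.Nat.Properties hiding (_≟_)
open import Data.Nat.Logarithm using (⌈log₂_⌉; ⌈log₂⌉-mono-≤; ⌈log₂2^n⌉≡n)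
open import Data.Nat.Logarithm.Core using (⌈log2⌉)
open import Data.Nat.Induction using (<-wellFounded)
open import Data.Nat.Tactic.RingSolver using (solve-∀)
import Data.Nat.ListAction as List
open import Data.Bool using (Bool; true; false; _∧_; if_then_else_)
open import Data.Bool.Properties using (∧-zeroʳ; ∧-conicalˡ; ∧-conicalʳ; T-≡; ¬-not)
open import Data.Fin using (Fin; zero; suc; _≟_)
import Data.Fin.Properties as Fin
open import Data.List using (List; []; _∷_; _++_; _∷ʳ_; length; tabulate)
open import Data.List.Properties using (map-tabulate; length-++; ∷-injectiveˡ; ∷ʳ-injectiveˡ; ∷ʳ-injectiveʳ)
open import Data.List.Relation.Unary.All as All using (All; []; _∷_)
open import Data.List.Relation.Unary.All.Properties using (∷ʳ⁺)
open import Data.List.Relation.Unary.AllPairs using (AllPairs; []; _∷_)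
open import Data.List.Relation.Unary.Any using (Any; here; there)
open import Data.List.Relation.Unary.Linked as Linked using (Linked; []; [-]; _∷_)
open import Data.List.Relation.Unary.Unique.Propositional using (Unique)
import Data.List.Relation.Unary.Unique.Propositional.Properties as Unique
open import Data.List.Membership.Propositional using (_∈_; _∉_; find; lose)
open import Data.List.Membership.Propositional.Properties using (∈-∃++; ∈-++⁺ˡ; ∈-++⁺ʳ)
open import Data.Product using (Σ; ∃; ∃₂; _×_; _,_; proj₁; proj₂)
open import Data.Sum using (_⊎_; inj₁; inj₂; [_,_]′)
open import Data.Empty using (⊥; ⊥-elim)
open import Algebra.Properties.CommutativeMonoid.Sum +-0-commutativeMonoid
  using (sum; sum-syntax; sum-cong-≗; ∑-distrib-+; sum-replicate-zero)
open import Algebra.Properties.CommutativeSemigroup +-commutativeSemigroup using (x∙yz≈y∙xz)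
open import Function using (_∘_)
open import Function.Bundles using (Equivalence)
open import Induction.WellFounded using (Acc; acc)
open import Relation.Nullary using (¬_; does; yes; no; contradiction; ¬¬-map)
open import Relation.Nullary.Decidable using (decidable-stable)
open import Relation.Binary.PropositionalEquality

-- Finite sums and counting

𝟙 : Bool → ℕ
𝟙 b = if b then 1 else 0

𝟙≤1 : ∀ b → 𝟙 b ≤ 1
𝟙≤1 true  = ≤-refl
𝟙≤1 false = z≤n

sum-mono-≤ : ∀ {n} {g h : Fin n → ℕ} → (∀ u → g u ≤ h u) → sum g ≤ sum h
sum-mono-≤ {zero}  g≤h = z≤n
sum-mono-≤ {suc n} g≤h = +-mono-≤ (g≤h zero) (sum-mono-≤ (g≤h ∘ suc))

sum≤n : ∀ {n} (g : Fin n → ℕ) → (∀ u → g u ≤ 1) → sum g ≤ n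
sum≤n {zero}  g g≤1 = z≤n
sum≤n {suc n} g g≤1 = +-mono-≤ (g≤1 zero) (sum≤n (g ∘ suc) (g≤1 ∘ suc))

sum≡0⇒≡0 : ∀ {n} (g : Fin n → ℕ) → sum g ≡ 0 → ∀ u → g u ≡ 0
sum≡0⇒≡0 {suc n} g Σ≡0 zero    = m+n≡0⇒m≡0 (g zero) Σ≡0
sum≡0⇒≡0 {suc n} g Σ≡0 (suc u) = sum≡0⇒≡0 (g ∘ suc) (m+n≡0⇒n≡0 (g zero) Σ≡0) u

sum-split : ∀ {n} (h h' : Fin n → ℕ) x → h' x ≡ 0 → (∀ u → u ≢ x → h u ≡ h' u) →
            sum h ≡ h x + sum h'
sum-split {suc n} h h' zero h'x≡0 h≡h' = cong (h zero +_) (begin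
  sum (h ∘ suc)             ≡⟨ sum-cong-≗ (λ u → h≡h' (suc u) λ ()) ⟩
  sum (h' ∘ suc)            ≡⟨ cong (_+ sum (h' ∘ suc)) h'x≡0 ⟨
  h' zero + sum (h' ∘ suc)  ∎)
  where open ≡-Reasoning
sum-split {suc n} h h' (suc x) h'x≡0 h≡h' = begin
  h zero + sum (h ∘ suc)                    ≡⟨ cong₂ _+_ (h≡h' zero λ ()) (sum-split (h ∘ suc) (h' ∘ suc) x h'x≡0
                                                 λ u u≢x → h≡h' (suc u) (u≢x ∘ Fin.suc-injective)) ⟩
  h' zero + (h (suc x) + sum (h' ∘ suc))    ≡⟨ x∙yz≈y∙xz (h' zero) (h (suc x)) _ ⟩
  h (suc x) + (h' zero + sum (h' ∘ suc))    ∎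
  where open ≡-Reasoning

count≡∑ : ∀ {n} (f : Fin n → Bool) → count f ≡ ∑[ u < n ] 𝟙 (f u)
count≡∑ {n} f = trans (cong List.sum (map-tabulate (λ u → u) (𝟙 ∘ f))) (sum-tabulate (𝟙 ∘ f))
  where
  sum-tabulate : ∀ {m} (g : Fin m → ℕ) → List.sum (tabulate g) ≡ sum g
  sum-tabulate {zero}  g = refl
  sum-tabulate {suc m} g = cong (g zero +_) (sum-tabulate (g ∘ suc))

sum-pos : ∀ {n} (h : Fin n → ℕ) → 1 ≤ sum h → ∃ λ u → 1 ≤ h u
sum-pos {suc n} h 1≤Σ with h zero in h0≡
... | suc _ = zero , subst (1 ≤_) (sym h0≡) (s≤s z≤n)
... | zero  = let u , 1≤hu = sum-pos (h ∘ suc) 1≤Σ in suc u , 1≤hu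

remove : ∀ {n} → Fin n → (Fin n → Bool) → Fin n → Bool
remove x f u = if does (u ≟ x) then false else f u

remove-self : ∀ {n} x (f : Fin n → Bool) → remove x f x ≡ false
remove-self x f with x ≟ x
... | yes _   = refl
... | no x≢x  = contradiction refl x≢x

remove-other : ∀ {n} {x u} (f : Fin n → Bool) → u ≢ x → remove x f u ≡ f u
remove-other {x = x} {u} f u≢x with u ≟ x
... | yes u≡x = contradiction u≡x u≢x
... | no _    = refl

remove-true : ∀ {n} {x u} (f : Fin n → Bool) → remove x f u ≡ true → u ≢ x × f u ≡ true
remove-true {x = x} {u} f fu with u ≟ x
... | no u≢x = u≢x , fu

count-cong : ∀ {n} {f g : Fin n → Bool} → (∀ u → f u ≡ g u) → count f ≡ count g
count-cong {f = f} {g} f≗g = begin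
  count f                ≡⟨ count≡∑ f ⟩
  ∑[ u < _ ] 𝟙 (f u)     ≡⟨ sum-cong-≗ (cong 𝟙 ∘ f≗g) ⟩
  ∑[ u < _ ] 𝟙 (g u)     ≡⟨ count≡∑ g ⟨
  count g                ∎
  where open ≡-Reasoning

count-mono : ∀ {n} {f g : Fin n → Bool} → (∀ u → f u ≡ true → g u ≡ true) → count f ≤ count g
count-mono {f = f} {g} f⊆g = subst₂ _≤_ (sym (count≡∑ f)) (sym (count≡∑ g)) (sum-mono-≤ λ u → 𝟙-mono (f⊆g u))
  where
  𝟙-mono : ∀ {a b} → (a ≡ true → b ≡ true) → 𝟙 a ≤ 𝟙 b
  𝟙-mono {false} a⇒b = z≤n
  𝟙-mono {true}  a⇒b rewrite a⇒b refl = ≤-refl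

count≤n : ∀ {n} (f : Fin n → Bool) → count f ≤ n
count≤n f = subst (_≤ _) (sym (count≡∑ f)) (sum≤n _ (𝟙≤1 ∘ f))

count≡0⇒false : ∀ {n} (f : Fin n → Bool) → count f ≡ 0 → ∀ u → f u ≡ false
count≡0⇒false f #f≡0 u with f u | sum≡0⇒≡0 (𝟙 ∘ f) (trans (sym (count≡∑ f)) #f≡0) u
... | false | _ = refl

count-pos : ∀ {n} (f : Fin n → Bool) → 1 ≤ count f → ∃ λ x → f x ≡ true
count-pos f 1≤#f with sum-pos (𝟙 ∘ f) (subst (1 ≤_) (count≡∑ f) 1≤#f)
... | x , 1≤fx with f x in fx≡
...   | true = x , fx≡

count-remove : ∀ {n} x (f : Fin n → Bool) → count f ≡ 𝟙 (f x) + count (remove x f)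
count-remove x f = begin
  count f                                      ≡⟨ count≡∑ f ⟩
  ∑[ u < _ ] 𝟙 (f u)                           ≡⟨ sum-split (𝟙 ∘ f) (𝟙 ∘ remove x f) x (cong 𝟙 (remove-self x f))
                                                    (λ u u≢x → cong 𝟙 (sym (remove-other f u≢x))) ⟩
  𝟙 (f x) + ∑[ u < _ ] 𝟙 (remove x f u)        ≡⟨ cong (𝟙 (f x) +_) (count≡∑ (remove x f)) ⟨
  𝟙 (f x) + count (remove x f)                 ∎
  where open ≡-Reasoning

count-remove-true : ∀ {n} {x} (f : Fin n → Bool) → f x ≡ true → count f ≡ suc (count (remove x f))
count-remove-true {x = x} f fx = trans (count-remove x f) (cong (λ b → 𝟙 b + count (remove x f)) fx)

length≤count : ∀ {n} {xs : List (Fin n)} (f : Fin n → Bool) →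
               Unique xs → All (λ x → f x ≡ true) xs → length xs ≤ count f
length≤count f [] [] = z≤n
length≤count f (x∉xs ∷ xs!) (fx ∷ fxs) = subst (suc _ ≤_) (sym (count-remove-true f fx))
  (s≤s (length≤count (remove _ f) xs! (All.zipWith (λ (x≢y , fy) → trans (remove-other f (x≢y ∘ sym)) fy) (x∉xs , fxs))))

count≥2⇒distinct : ∀ {n} (f : Fin n → Bool) → 2 ≤ count f →
                   ∃ λ x → ∃ λ y → x ≢ y × f x ≡ true × f y ≡ true
count≥2⇒distinct f 2≤#f with count-pos f (≤-trans (s≤s z≤n) 2≤#f)
... | x , fx with count-pos (remove x f) (≤-pred (subst (2 ≤_) (count-remove-true f fx) 2≤#f))
...   | y , f'y with remove-true f f'y
...     | y≢x , fy = x , y , y≢x ∘ sym , fx , fy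

count-+ : ∀ {n} (f g : Fin n → Bool) → count f + count g ≡ ∑[ u < n ] (𝟙 (f u) + 𝟙 (g u))
count-+ f g = trans (cong₂ _+_ (count≡∑ f) (count≡∑ g)) (sym (∑-distrib-+ (𝟙 ∘ f) (𝟙 ∘ g)))

count-disjoint-+ : ∀ {n} {f g h : Fin n → Bool} → (∀ u → f u ≡ true → g u ≢ true) →
                   (∀ u → f u ≡ true → h u ≡ true) → (∀ u → g u ≡ true → h u ≡ true) →
                   count f + count g ≤ count h
count-disjoint-+ {f = f} {g} {h} f∩g=∅ f⊆h g⊆h = subst₂ _≤_ (sym (count-+ f g)) (sym (count≡∑ h))
  (sum-mono-≤ λ u → 𝟙-disjoint (f∩g=∅ u) (f⊆h u) (g⊆h u))
  where
  𝟙-disjoint : ∀ {a b c} → (a ≡ true → b ≢ true) → (a ≡ true → c ≡ true) → (b ≡ true → c ≡ true) → 𝟙 a + 𝟙 b ≤ 𝟙 c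
  𝟙-disjoint {false} {false} _  _   _  = z≤n
  𝟙-disjoint {true}  {true}  a∩b _  _  = contradiction refl (a∩b refl)
  𝟙-disjoint {true}  {false} _  a⇒c _  rewrite a⇒c refl = ≤-refl
  𝟙-disjoint {false} {true}  _  _  b⇒c rewrite b⇒c refl = ≤-refl

false≢true : false ≢ true
false≢true ()

∧-≤ᵇ⁻ : ∀ b m k → (b ∧ (m ≤ᵇ k)) ≡ true → b ≡ true × m ≤ k
∧-≤ᵇ⁻ b m k e = ∧-conicalˡ b _ e , ≤ᵇ⇒≤ m k (Equivalence.from T-≡ (∧-conicalʳ b _ e))

∧-≤ᵇ⁺ : ∀ {b m k} → b ≡ true → m ≤ k → (b ∧ (m ≤ᵇ k)) ≡ true
∧-≤ᵇ⁺ b≡true m≤k = cong₂ _∧_ b≡true (Equivalence.to T-≡ (≤⇒≤ᵇ m≤k))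

-- Arithmetic

halving-< : ∀ {c L m} → (1 ≤ c → c + 2 ≤ L) → c + L ≤ m → 1 ≤ m → c * 2 < m
halving-< {zero}          _     _     1≤m = 1≤m
halving-< {suc c} {L} {m} c+2≤L c+L≤m _   = begin-strict
  suc c * 2        ≡⟨ *-comm (suc c) 2 ⟩
  2 * suc c        ≡⟨ cong (suc c +_) (+-identityʳ (suc c)) ⟩
  suc c + suc c    <⟨ +-monoʳ-< (suc c) (≤-trans (m<m+n (suc c) z<s) (c+2≤L (s≤s z≤n))) ⟩
  suc c + L        ≤⟨ c+L≤m ⟩
  m                ∎
  where open ≤-Reasoning

halving-≤ : ∀ {c L m} → (1 ≤ c → c + 2 ≤ L) → c + L ≤ m → c * 2 ≤ m
halving-≤ {zero}  _     _     = z≤n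
halving-≤ {suc c} {L} c+2≤L c+L≤m = <⇒≤ (halving-< c+2≤L c+L≤m (≤-trans (s≤s z≤n) (≤-trans (m≤m+n (suc c) L) c+L≤m)))

halving-sequence : ∀ {n} (c : ℕ → ℕ) → c 1 * 2 < n → (∀ i → 1 ≤ i → c (suc i) * 2 ≤ c i) →
                   ∀ i → 1 ≤ i → c i * 2 ^ i < n
halving-sequence c c₁*2<n halves (suc zero)    _ = c₁*2<n
halving-sequence {n} c c₁*2<n halves (suc (suc i)) _ = begin-strict
  c (2 + i) * 2 ^ (2 + i)     ≡⟨ *-assoc (c (2 + i)) 2 (2 ^ suc i) ⟨
  c (2 + i) * 2 * 2 ^ (1 + i) ≤⟨ *-monoˡ-≤ (2 ^ suc i) (halves (suc i) (s≤s z≤n)) ⟩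
  c (1 + i) * 2 ^ (1 + i)     <⟨ halving-sequence c c₁*2<n halves (suc i) (s≤s z≤n) ⟩
  n                           ∎
  where open ≤-Reasoning

n≤2^⌈log₂n⌉ : ∀ n → n ≤ 2 ^ ⌈log₂ n ⌉
n≤2^⌈log₂n⌉ n = bound n (<-wellFounded n)
  where
  bound : ∀ m (acc : Acc _<_ m) → m ≤ 2 ^ ⌈log2⌉ m acc
  bound 0             _        = z≤n
  bound 1             _        = ≤-refl
  bound (suc (suc m)) (acc rs) = begin
    2 + m                          ≡⟨ cong (2 +_) (⌊n/2⌋+⌈n/2⌉≡n m) ⟨
    2 + (⌊ m /2⌋ + ⌈ m /2⌉)        ≤⟨ s≤s (s≤s (+-monoˡ-≤ ⌈ m /2⌉ (⌊n/2⌋≤⌈n/2⌉ m))) ⟩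
    2 + (⌈ m /2⌉ + ⌈ m /2⌉)        ≡⟨ cong suc (+-suc ⌈ m /2⌉ ⌈ m /2⌉) ⟨
    suc ⌈ m /2⌉ + suc ⌈ m /2⌉      ≤⟨ +-mono-≤ ih ih ⟩
    2 ^ k + 2 ^ k                  ≡⟨ cong (2 ^ k +_) (+-identityʳ (2 ^ k)) ⟨
    2 ^ suc k                      ∎
    where
    open ≤-Reasoning
    k = ⌈log2⌉ (suc ⌈ m /2⌉) (rs (⌈n/2⌉<n m))
    ih = bound (suc ⌈ m /2⌉) (rs (⌈n/2⌉<n m))

1≤⌈log₂n⌉ : ∀ {n} → 2 ≤ n → 1 ≤ ⌈log₂ n ⌉
1≤⌈log₂n⌉ {n} 2≤n = subst (_≤ ⌈log₂ n ⌉) (⌈log₂2^n⌉≡n 1) (⌈log₂⌉-mono-≤ 2≤n)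

*<≥⇒≡0 : ∀ {c m n} → c * m < n → n ≤ m → c ≡ 0
*<≥⇒≡0 {zero}  _     _   = refl
*<≥⇒≡0 {suc c} c*m<n n≤m = contradiction (≤-trans n≤m (m≤m+n _ _)) (<⇒≱ c*m<n)

-- Paths

module _ {a r} {A : Set a} {R : A → A → Set r} where

  All-prefix : ∀ {P : A → Set r} xs {y} zs → All P (xs ++ y ∷ zs) → All P (xs ++ y ∷ [])
  All-prefix []       zs (py ∷ _)   = py ∷ []
  All-prefix (x ∷ xs) zs (px ∷ pxs) = px ∷ All-prefix xs zs pxs

  AllPairs-prefix : ∀ xs {y} zs → AllPairs R (xs ++ y ∷ zs) → AllPairs R (xs ++ y ∷ [])
  AllPairs-prefix []       zs _          = [] ∷ []
  AllPairs-prefix (x ∷ xs) zs (Rx ∷ Rxs) = All-prefix xs zs Rx ∷ AllPairs-prefix xs zs Rxs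

  Linked-prefix : ∀ xs {y} zs → Linked R (xs ++ y ∷ zs) → Linked R (xs ++ y ∷ [])
  Linked-prefix []            zs _           = [-]
  Linked-prefix (x ∷ [])      zs (Rxy ∷ _)   = Rxy ∷ [-]
  Linked-prefix (x ∷ x′ ∷ xs) zs (Rxx′ ∷ Rs) = Rxx′ ∷ Linked-prefix (x′ ∷ xs) zs Rs

  Linked-∷ʳ : ∀ xs {u v} → Linked R (xs ∷ʳ u) → R u v → Linked R (xs ∷ʳ u ∷ʳ v)
  Linked-∷ʳ []            _           Ruv = Ruv ∷ [-]
  Linked-∷ʳ (x ∷ [])      (Rxu ∷ _)   Ruv = Rxu ∷ Ruv ∷ [-]
  Linked-∷ʳ (x ∷ x′ ∷ xs) (Rxx′ ∷ Rs) Ruv = Rxx′ ∷ Linked-∷ʳ (x′ ∷ xs) Rs Ruv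

∷ʳ≢[] : ∀ {a} {A : Set a} {xs : List A} {x} → xs ∷ʳ x ≢ []
∷ʳ≢[] {xs = []}    ()
∷ʳ≢[] {xs = _ ∷ _} ()

∈∉⇒≢ : ∀ {a} {A : Set a} {xs : List A} {x y} → x ∈ xs → y ∉ xs → x ≢ y
∈∉⇒≢ x∈ y∉ refl = y∉ x∈

Unique-∷ʳ : ∀ {a} {A : Set a} {xs : List A} {v} → Unique xs → v ∉ xs → Unique (xs ∷ʳ v)
Unique-∷ʳ xs! v∉xs = Unique.++⁺ xs! ([] ∷ []) λ { (v∈xs , here refl) → v∉xs v∈xs }

module _ {n : ℕ} (F : Forest n) (S : Fin n → Bool) where

  open import Data.List.Membership.DecPropositional (_≟_ {n}) using (_∈?_)

  _~_ : Fin n → Fin n → Set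
  x ~ y = adj F x y ≡ true

  ~-sym : ∀ {x y} → x ~ y → y ~ x
  ~-sym {x} {y} x~y = trans (adj-sym F y x) x~y

  ~-irrefl : ∀ {x} → ¬ x ~ x
  ~-irrefl {x} x~x = false≢true (trans (sym (irrefl F x)) x~x)

  Neighbour : Fin n → Fin n → Set
  Neighbour v a = S a ≡ true × v ~ a

  length≤deg : ∀ {v as} → Unique as → All (Neighbour v) as → length as ≤ deg F S v
  length≤deg as! nbs = length≤count _ as! (All.map (λ (Sa , v~a) → cong₂ _∧_ Sa v~a) nbs)

  neighbour⇒deg≥1 : ∀ {v a} → Neighbour v a → 1 ≤ deg F S v
  neighbour⇒deg≥1 na = length≤deg ([] ∷ []) (na ∷ [])

  neighbours⇒deg≥2 : ∀ {v a b} → a ≢ b → Neighbour v a → Neighbour v b → 2 ≤ deg F S v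
  neighbours⇒deg≥2 a≢b na nb = length≤deg ((a≢b ∷ []) ∷ [] ∷ []) (na ∷ nb ∷ [])

  neighbours⇒deg≥3 : ∀ {v a b c} → a ≢ b → a ≢ c → b ≢ c →
                     Neighbour v a → Neighbour v b → Neighbour v c → 3 ≤ deg F S v
  neighbours⇒deg≥3 a≢b a≢c b≢c na nb nc =
    length≤deg ((a≢b ∷ a≢c ∷ []) ∷ (b≢c ∷ []) ∷ [] ∷ []) (na ∷ nb ∷ nc ∷ [])

  deg≥2⇒neighbours : ∀ {v} → 2 ≤ deg F S v → ∃₂ λ a b → a ≢ b × Neighbour v a × Neighbour v b
  deg≥2⇒neighbours {v} 2≤d =
    let a , b , a≢b , na , nb = count≥2⇒distinct (λ u → S u ∧ adj F v u) 2≤d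
    in a , b , a≢b , split na , split nb
    where
    split : ∀ {u} → (S u ∧ adj F v u) ≡ true → Neighbour v u
    split {u} e = ∧-conicalˡ (S u) _ e , ∧-conicalʳ (S u) _ e

  module _ {ps : List (Fin n)} (p : IsPath F S ps) where

    path-unique : Unique ps
    path-unique = proj₁ (proj₂ p)

    path-⊆S : All (λ v → S v ≡ true) ps
    path-⊆S = proj₁ (proj₂ (proj₂ p))

    path-linked : Linked _~_ ps
    path-linked = proj₂ (proj₂ (proj₂ p))

  path-∷ : ∀ {u v rest} → IsPath F S (u ∷ rest) → v ∉ u ∷ rest → Neighbour u v → IsPath F S (v ∷ u ∷ rest)
  path-∷ (_ , ps! , ps⊆S , ps~) v∉ (Sv , u~v) =
    (λ ()) , All.tabulate (λ x∈ → ∈∉⇒≢ x∈ v∉ ∘ sym) ∷ ps! , Sv ∷ ps⊆S , ~-sym u~v ∷ ps~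

  path-∷ʳ : ∀ rest {u v} → IsPath F S (rest ∷ʳ u) → v ∉ rest ∷ʳ u → Neighbour u v → IsPath F S (rest ∷ʳ u ∷ʳ v)
  path-∷ʳ rest (_ , ps! , ps⊆S , ps~) v∉ (Sv , u~v) =
    ∷ʳ≢[] , Unique-∷ʳ ps! v∉ , ∷ʳ⁺ ps⊆S Sv , Linked-∷ʳ rest ps~ u~v

  OnMaximal : (List (Fin n) → Set) → Fin n → Set
  OnMaximal P v = ∃ λ ps → Maximal F S P ps × v ∈ ps

  -- Paths have at most n vertices, so enlarging cannot go on forever; as P need not be
  -- decidable, only the double negation follows.
  on-path⇒on-maximal : ∀ (P : List (Fin n) → Set) → (∀ {ps} → P ps → Unique ps) →
                       ∀ {v ps} → P ps → v ∈ ps → ¬ ¬ OnMaximal P v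
  on-path⇒on-maximal P P⇒unique {v} Pps v∈ps ¬onMax = enlarge (suc n) (s≤s (m≤m+n n _)) Pps v∈ps
    where
    enlarge : ∀ k {ps} → n < k + length ps → P ps → v ∈ ps → ⊥
    enlarge zero    {ps} n<|ps| Pps _ =
      <⇒≱ n<|ps| (≤-trans (length≤count (λ _ → true) (P⇒unique Pps) (All.universal (λ _ → refl) ps)) (count≤n _))
    enlarge (suc k) {ps} n<k+|ps| Pps v∈ps = ¬onMax (ps , (Pps , λ w w∉ps →
        (λ Pw∷ps → enlarge k (subst (n <_) (sym (+-suc k _)) n<k+|ps|) Pw∷ps (there v∈ps)) ,
        (λ Pps∷w → enlarge k (subst (n <_) (sym (cong (k +_) |ps∷ʳw|)) (subst (n <_) (sym (+-suc k _)) n<k+|ps|))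
                     Pps∷w (∈-++⁺ˡ v∈ps))) , v∈ps)
      where
      |ps∷ʳw| : ∀ {w} → length (ps ∷ʳ w) ≡ suc (length ps)
      |ps∷ʳw| = trans (length-++ ps) (+-comm (length ps) 1)

  path-no-chord : ∀ {h m rest y} → IsPath F S (h ∷ m ∷ rest) → y ∈ rest → ¬ h ~ y
  path-no-chord {h} {m} p y∈rest h~y with ∈-∃++ y∈rest
  ... | mid , zs , refl with acyclic F h m mid _ (AllPairs-prefix (h ∷ m ∷ mid) zs (path-unique p))
                                                 (Linked-prefix (h ∷ m ∷ mid) zs (path-linked p))
  ... | y≁h = false≢true (trans (sym y≁h) (~-sym h~y))

  path-neighbour-of-head : ∀ {h rest y} → IsPath F S (h ∷ rest) → h ~ y → y ∈ h ∷ rest →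
                           ∃ λ rest′ → rest ≡ y ∷ rest′
  path-neighbour-of-head p h~y (here refl)            = contradiction h~y ~-irrefl
  path-neighbour-of-head p h~y (there (here refl))    = _ , refl
  path-neighbour-of-head p h~y (there (there y∈rest)) = contradiction h~y (path-no-chord p y∈rest)

  head-deg≤1 : ∀ {h rest} → IsPath F S (h ∷ rest) → (∀ y → y ∉ h ∷ rest → ¬ Neighbour h y) → deg F S h ≤ 1
  head-deg≤1 {h} {rest} p closed = decidable-stable (deg F S h ≤? 1) λ d≰1 →
    let a , b , a≢b , na , nb = deg≥2⇒neighbours (≰⇒> d≰1)
    in a≢b (∷-injectiveˡ (trans (sym (proj₂ (second na))) (proj₂ (second nb))))
    where
    second : ∀ {y} → Neighbour h y → ∃ λ rest′ → rest ≡ y ∷ rest′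
    second {y} ny with y ∈? h ∷ rest
    ... | yes y∈ = path-neighbour-of-head p (proj₂ ny) y∈
    ... | no y∉  = contradiction ny (closed y y∉)

  data Position (u : Fin n) : List (Fin n) → Set where
    alone : Position u (u ∷ [])
    first : ∀ {z} rest → u ~ z → Position u (u ∷ z ∷ rest)
    last  : ∀ {z} rest → z ~ u → Position u (rest ∷ʳ z ∷ʳ u)
    inner : ∀ {a b ps} → a ≢ b → u ~ a → u ~ b → a ∈ ps → b ∈ ps → Position u ps

  position : ∀ {u ps} → Unique ps → Linked _~_ ps → u ∈ ps → Position u ps
  position {ps = _ ∷ []}       _ _         (here refl) = alone
  position {ps = _ ∷ _ ∷ rest} _ (x~z ∷ _) (here refl) = first rest x~z
  position {ps = x ∷ xs} (x∉xs ∷ xs!) x~xs (there u∈xs) with position xs! (Linked.tail x~xs) u∈xs | x~xs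
  ... | alone                         | x~u ∷ _ = last [] x~u
  ... | first _ u~z                   | x~u ∷ _ = inner (All.head (All.tail x∉xs)) (~-sym x~u) u~z (here refl) (there (there (here refl)))
  ... | last rest z~u                 | _       = last (x ∷ rest) z~u
  ... | inner a≢b u~a u~b a∈xs b∈xs   | _       = inner a≢b u~a u~b (there a∈xs) (there b∈xs)

  inner-deg≥3 : ∀ {u v a b ps} → IsPath F S ps → a ≢ b → u ~ a → u ~ b → a ∈ ps → b ∈ ps →
                v ∉ ps → Neighbour u v → 3 ≤ deg F S u
  inner-deg≥3 p a≢b u~a u~b a∈ b∈ v∉ nv =
    neighbours⇒deg≥3 a≢b (∈∉⇒≢ a∈ v∉) (∈∉⇒≢ b∈ v∉)
      (All.lookup (path-⊆S p) a∈ , u~a) (All.lookup (path-⊆S p) b∈ , u~b) nv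

  PendantEnd : List (Fin n) → Set
  PendantEnd ps = (Σ (Fin n) λ v → Σ (List (Fin n)) λ rest → ps ≡ v ∷ rest × deg F S v ≡ 1)
                ⊎ (Σ (Fin n) λ v → Σ (List (Fin n)) λ rest → ps ≡ rest ∷ʳ v × deg F S v ≡ 1)
                ⊎ (Σ (Fin n) λ v → ps ≡ v ∷ [] × deg F S v ≡ 0)

  Unextendable : (List (Fin n) → Set) → List (Fin n) → Set
  Unextendable P ps = ∀ w → w ∉ ps → ¬ P (w ∷ ps) × ¬ P (ps ∷ʳ w)

  -- An inner vertex u would have degree 3; an end vertex u could be extended by v.
  maximal-pendant-closed : ∀ {ps u v} → Maximal F S (PendantPath F S) ps → u ∈ ps → v ∉ ps →
                           Neighbour u v → ¬ deg F S v ≤ 2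
  maximal-pendant-closed {u = u} {v} ((bp , end) , unext) u∈ps v∉ps nv dv≤2 =
    closed (position (path-unique (proj₁ bp)) (path-linked (proj₁ bp)) u∈ps) bp end unext v∉ps
    where
    du≤2 : deg F S u ≤ 2
    du≤2 = All.lookup (proj₂ bp) u∈ps

    grow-front : ∀ {rest} → BinaryPath F S (u ∷ rest) → v ∉ u ∷ rest → BinaryPath F S (v ∷ u ∷ rest)
    grow-front (p , ≤2) v∉ = path-∷ p v∉ nv , dv≤2 ∷ ≤2

    grow-back : ∀ rest → BinaryPath F S (rest ∷ʳ u) → v ∉ rest ∷ʳ u → BinaryPath F S (rest ∷ʳ u ∷ʳ v)
    grow-back rest (p , ≤2) v∉ = path-∷ʳ rest p v∉ nv , ∷ʳ⁺ ≤2 dv≤2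

    du≢1 : ∀ {z ps} → BinaryPath F S ps → z ∈ ps → v ∉ ps → u ~ z → deg F S u ≢ 1
    du≢1 (p , _) z∈ v∉ u~z = <⇒≢ (neighbours⇒deg≥2 (∈∉⇒≢ z∈ v∉) (All.lookup (path-⊆S p) z∈ , u~z) nv) ∘ sym

    closed : ∀ {ps} → Position u ps → BinaryPath F S ps → PendantEnd ps → Unextendable (PendantPath F S) ps → v ∉ ps → ⊥
    closed (inner a≢b u~a u~b a∈ b∈) (p , _) _ _ v∉ = <⇒≱ (inner-deg≥3 p a≢b u~a u~b a∈ b∈ v∉ nv) du≤2
    closed alone bp (inj₁ (_ , _ , refl , du≡1)) unext v∉ =
      proj₁ (unext v v∉) (grow-front bp v∉ , inj₂ (inj₁ (u , v ∷ [] , refl , du≡1)))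
    closed alone bp (inj₂ (inj₁ (_ , rest , eq , du≡1))) unext v∉ with ∷ʳ-injectiveʳ [] rest eq
    ... | refl = proj₁ (unext v v∉) (grow-front bp v∉ , inj₂ (inj₁ (u , v ∷ [] , refl , du≡1)))
    closed alone bp (inj₂ (inj₂ (_ , refl , du≡0))) _ _ = <⇒≢ (neighbour⇒deg≥1 nv) (sym du≡0)
    closed (first _ u~z) bp (inj₁ (_ , _ , refl , du≡1)) _ v∉ = du≢1 bp (there (here refl)) v∉ u~z du≡1
    closed (first _ u~z) bp (inj₂ (inj₁ (y , rest′ , eq , dy≡1))) unext v∉ =
      proj₁ (unext v v∉) (grow-front bp v∉ , inj₂ (inj₁ (y , v ∷ rest′ , cong (v ∷_) eq , dy≡1)))
    closed (first _ u~z) bp (inj₂ (inj₂ (_ , () , _))) _ _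
    closed (last rest z~u) bp (inj₁ (y , rest′ , eq , dy≡1)) unext v∉ =
      proj₂ (unext v v∉) (grow-back (rest ∷ʳ _) bp v∉ , inj₁ (y , rest′ ∷ʳ v , cong (_∷ʳ v) eq , dy≡1))
    closed (last rest z~u) bp (inj₂ (inj₁ (_ , rest′ , eq , du≡1))) _ v∉ with ∷ʳ-injectiveʳ (rest ∷ʳ _) rest′ eq
    ... | refl = du≢1 bp (∈-++⁺ˡ (∈-++⁺ʳ rest (here refl))) v∉ (~-sym z~u) du≡1
    closed (last rest z~u) bp (inj₂ (inj₂ (_ , eq , _))) _ _ = ∷ʳ≢[] (∷ʳ-injectiveˡ (rest ∷ʳ _) [] eq)

  maximal-internal-closed : ∀ {ps u v} → Maximal F S (InternalPath F S) ps → u ∈ ps → v ∉ ps →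
                            Neighbour u v → deg F S v ≢ 2
  maximal-internal-closed {u = u} {v} ((p , ≡2) , unext) u∈ps v∉ps nv dv≡2 =
    closed (position (path-unique p) (path-linked p) u∈ps) p ≡2 unext v∉ps
    where
    closed : ∀ {ps} → Position u ps → IsPath F S ps → All (λ w → deg F S w ≡ 2) ps →
             Unextendable (InternalPath F S) ps → v ∉ ps → ⊥
    closed (inner a≢b u~a u~b a∈ b∈) p _ _ v∉ =
      <⇒≢ (inner-deg≥3 p a≢b u~a u~b a∈ b∈ v∉ nv) (sym (All.lookup ≡2 u∈ps))
    closed alone            p ≡2 unext v∉ = proj₁ (unext v v∉) (path-∷ p v∉ nv , dv≡2 ∷ ≡2)
    closed (first _ _)      p ≡2 unext v∉ = proj₁ (unext v v∉) (path-∷ p v∉ nv , dv≡2 ∷ ≡2)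
    closed (last rest _)    p ≡2 unext v∉ = proj₂ (unext v v∉) (path-∷ʳ (rest ∷ʳ _) p v∉ nv , ∷ʳ⁺ ≡2 dv≡2)

  deg-mono : ∀ {T v} → (∀ {u} → Neighbour v u → T u ≡ true) → deg F S v ≤ deg F T v
  deg-mono {T} {v} N⊆T = count-mono λ u e →
    cong₂ _∧_ (N⊆T (∧-conicalˡ (S u) _ e , ∧-conicalʳ (S u) _ e)) (∧-conicalʳ (S u) _ e)

  singleton-path : ∀ {v} → S v ≡ true → IsPath F S (v ∷ [])
  singleton-path Sv = (λ ()) , [] ∷ [] , Sv ∷ [] , [-]

  isolated-head-end : ∀ {h rest} → IsPath F S (h ∷ rest) → deg F S h ≡ 0 → PendantEnd (h ∷ rest)
  isolated-head-end {rest = []}    _ dh≡0 = inj₂ (inj₂ (_ , refl , dh≡0))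
  isolated-head-end {rest = _ ∷ _} p dh≡0 = ⊥-elim (
    <⇒≢ (neighbour⇒deg≥1 (All.lookup (path-⊆S p) (there (here refl)) , Linked.head (path-linked p))) (sym dh≡0))

  head-pendant-end : ∀ {h rest} → IsPath F S (h ∷ rest) → deg F S h ≤ 1 → PendantEnd (h ∷ rest)
  head-pendant-end {h} {rest} p dh≤1 =
    [ isolated-head-end p ∘ n<1⇒n≡0 , (λ dh≡1 → inj₁ (h , rest , refl , dh≡1)) ]′ (m≤n⇒m<n∨m≡n dh≤1)

  pendant-unique : ∀ {ps} → PendantPath F S ps → Unique ps
  pendant-unique ((p , _) , _) = path-unique p

  deg≤1⇒on-maximal-pendant : ∀ {v} → S v ≡ true → deg F S v ≤ 1 → ¬ ¬ OnMaximal (PendantPath F S) v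
  deg≤1⇒on-maximal-pendant Sv dv≤1 = on-path⇒on-maximal (PendantPath F S) pendant-unique
    ((singleton-path Sv , ≤-trans dv≤1 (n≤1+n 1) ∷ []) , head-pendant-end (singleton-path Sv) dv≤1) (here refl)

  -- The first vertex of a maximal path is a leaf or isolated.
  exists-deg≤1 : ∀ {x} → S x ≡ true → ¬ ¬ (∃ λ y → S y ≡ true × deg F S y ≤ 1)
  exists-deg≤1 Sx ¬leaf = on-path⇒on-maximal (IsPath F S) path-unique (singleton-path Sx) (here refl) λ where
    ([] , (p , _) , _)           → proj₁ p refl
    (h ∷ rest , (p , unext) , _) → ¬leaf (h , All.head (path-⊆S p) ,
      head-deg≤1 p λ y y∉ ny → proj₁ (unext y y∉) (path-∷ p y∉ ny))

  -- Without branch vertices, a maximal binary path is a maximal pendant path.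
  subcubic⇒on-maximal-pendant : (∀ w → S w ≡ true → deg F S w ≤ 2) →
                                ∀ {v} → S v ≡ true → ¬ ¬ OnMaximal (PendantPath F S) v
  subcubic⇒on-maximal-pendant ≤2 Sv ¬onMax =
    on-path⇒on-maximal (BinaryPath F S) (path-unique ∘ proj₁) (singleton-path Sv , ≤2 _ Sv ∷ []) (here refl) λ where
      ([] , ((p , _) , _) , _)                → proj₁ p refl
      (h ∷ rest , (bp@(p , ps≤2) , unext) , v∈) → ¬onMax (h ∷ rest ,
        ((bp , head-pendant-end p (head-deg≤1 p λ y y∉ ny → proj₁ (unext y y∉) (path-∷ p y∉ ny , ≤2 y (proj₁ ny) ∷ ps≤2))) ,
         λ w w∉ → proj₁ (unext w w∉) ∘ proj₁ , proj₂ (unext w w∉) ∘ proj₁) , v∈)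

  -- A surviving vertex of degree 2 keeps both neighbours, and one of degree ≤ 1 lies on a
  -- maximal pendant path.
  step-deg≤1⇒deg≥3 : ∀ {S′} → Step F S S′ → ∀ {v} → S′ v ≡ true → deg F S′ v ≤ 1 → 3 ≤ deg F S v
  step-deg≤1⇒deg≥3 {S′} (Qs , Qs-maximal , spec) {v} S′v d′v≤1 =
    ≰⇒> λ dv≤2 → [ dv≰1 ∘ ≤-pred , dv≢2 ]′ (m≤n⇒m<n∨m≡n dv≤2)
    where
    Sv : S v ≡ true
    Sv = proj₁ (proj₁ (spec v) S′v)
    ¬pendant-v : ¬ OnMaximal (PendantPath F S) v
    ¬pendant-v = proj₁ (proj₂ (proj₁ (spec v) S′v))
    ¬internal-v : ¬ Any (v ∈_) Qs
    ¬internal-v = proj₂ (proj₂ (proj₁ (spec v) S′v))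

    dv≰1 : ¬ deg F S v ≤ 1
    dv≰1 dv≤1 = deg≤1⇒on-maximal-pendant Sv dv≤1 ¬pendant-v

    neighbour-survives : deg F S v ≡ 2 → ∀ {u} → Neighbour v u → S′ u ≡ true
    neighbour-survives dv≡2 {u} (Su , v~u) = proj₂ (spec u) (Su , ¬pendant-u , ¬internal-u)
      where
      ¬pendant-u : ¬ OnMaximal (PendantPath F S) u
      ¬pendant-u (ps , max , u∈) =
        maximal-pendant-closed max u∈ (λ v∈ → ¬pendant-v (ps , max , v∈)) (Sv , ~-sym v~u) (≤-reflexive dv≡2)
      ¬internal-u : ¬ Any (u ∈_) Qs
      ¬internal-u u∈Qs =
        let Q , Q∈Qs , u∈Q = find u∈Qs
        in maximal-internal-closed (All.lookup Qs-maximal Q∈Qs) u∈Q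
             (λ v∈Q → ¬internal-v (lose Q∈Qs v∈Q)) (Sv , ~-sym v~u) dv≡2

    dv≢2 : deg F S v ≢ 2
    dv≢2 dv≡2 = <⇒≱ (subst (1 <_) (sym dv≡2) ≤-refl) (≤-trans (deg-mono (neighbour-survives dv≡2)) d′v≤1)

-- Degree counting in a forest

module _ {n : ℕ} (F : Forest n) where

  degreeSum : (Fin n → Bool) → ℕ
  degreeSum S = ∑[ v < n ] (if S v then deg F S v else 0)

  deg-remove : ∀ {S x} → S x ≡ true → ∀ v → deg F S v ≡ 𝟙 (adj F v x) + deg F (remove x S) v
  deg-remove {S} {x} Sx v = begin
    deg F S v
      ≡⟨ count-remove x _ ⟩
    𝟙 (S x ∧ adj F v x) + count (remove x (λ u → S u ∧ adj F v u))
      ≡⟨ cong₂ (λ b c → 𝟙 (b ∧ adj F v x) + c) Sx (count-cong remove-∧) ⟩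
    𝟙 (adj F v x) + deg F (remove x S) v
      ∎
    where
    open ≡-Reasoning
    remove-∧ : ∀ u → remove x (λ u → S u ∧ adj F v u) u ≡ (remove x S u ∧ adj F v u)
    remove-∧ u with u ≟ x
    ... | yes _ = refl
    ... | no _  = refl

  -- Deleting x removes its own term and one unit from each of its deg x neighbours.
  degreeSum-remove : ∀ {S x} → S x ≡ true → degreeSum S ≡ deg F S x + (degreeSum (remove x S) + deg F S x)
  degreeSum-remove {S} {x} Sx = begin
    degreeSum S
      ≡⟨ sum-split _ (λ v → if S′ v then deg F S v else 0) x (cong (λ b → if b then deg F S x else 0) (remove-self x S))
                   (λ u u≢x → cong (λ b → if b then deg F S u else 0) (sym (remove-other S u≢x))) ⟩
    (if S x then deg F S x else 0) + ∑[ v < n ] (if S′ v then deg F S v else 0)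
      ≡⟨ cong₂ _+_ (cong (λ b → if b then deg F S x else 0) Sx) (sum-cong-≗ term-split) ⟩
    deg F S x + ∑[ v < n ] ((if S′ v then deg F S′ v else 0) + 𝟙 (S′ v ∧ adj F v x))
      ≡⟨ cong (deg F S x +_) (∑-distrib-+ (λ v → if S′ v then deg F S′ v else 0) (λ v → 𝟙 (S′ v ∧ adj F v x))) ⟩
    deg F S x + (degreeSum S′ + ∑[ v < n ] 𝟙 (S′ v ∧ adj F v x))
      ≡⟨ cong (λ c → deg F S x + (degreeSum S′ + c)) (trans (sym (count≡∑ (λ v → S′ v ∧ adj F v x))) (count-cong neighbours-of-x)) ⟩
    deg F S x + (degreeSum S′ + deg F S x)
      ∎
    where
    open ≡-Reasoning
    S′ = remove x S
    term-split : ∀ v → (if S′ v then deg F S v else 0) ≡ (if S′ v then deg F S′ v else 0) + 𝟙 (S′ v ∧ adj F v x)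
    term-split v with S′ v
    ... | true  = trans (deg-remove Sx v) (+-comm (𝟙 (adj F v x)) _)
    ... | false = refl
    neighbours-of-x : ∀ v → (S′ v ∧ adj F v x) ≡ (S v ∧ adj F x v)
    neighbours-of-x v with v ≟ x
    ... | yes refl = sym (trans (cong (S v ∧_) (irrefl F v)) (∧-zeroʳ (S v)))
    ... | no _     = cong (S v ∧_) (adj-sym F v x)

  deg≤count-others : ∀ {S x} → S x ≡ true → deg F S x ≤ count (remove x S)
  deg≤count-others {S} {x} Sx = begin
    deg F S x                           ≡⟨ deg-remove Sx x ⟩
    𝟙 (adj F x x) + deg F (remove x S) x  ≡⟨ cong (λ b → 𝟙 b + deg F (remove x S) x) (irrefl F x) ⟩
    deg F (remove x S) x                ≤⟨ count-mono (λ u → ∧-conicalˡ (remove x S u) _) ⟩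
    count (remove x S)                  ∎
    where open ≤-Reasoning

  degreeSum≡0 : ∀ {S} → count S ≡ 0 → degreeSum S ≡ 0
  degreeSum≡0 {S} #S≡0 =
    trans (sum-cong-≗ λ v → cong (λ b → if b then deg F S v else 0) (count≡0⇒false S #S≡0 v)) (sum-replicate-zero n)

  -- A forest has fewer edges than vertices: delete a vertex of degree ≤ 1 and induct.
  degreeSum+2≤2*count : ∀ k {S} → count S ≡ suc k → degreeSum S + 2 ≤ 2 * suc k
  degreeSum+2≤2*count k {S} #S≡1+k =
    decidable-stable (_ ≤? _) (¬¬-map from-leaf (exists-deg≤1 F S (proj₂ (count-pos S (subst (1 ≤_) (sym #S≡1+k) (s≤s z≤n))))))
    where
    from-leaf : (∃ λ y → S y ≡ true × deg F S y ≤ 1) → degreeSum S + 2 ≤ 2 * suc k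
    from-leaf (y , Sy , dy≤1) = by-size k (suc-injective (trans (sym (count-remove-true S Sy)) #S≡1+k))
      where
      S′ = remove y S
      by-size : ∀ k → count S′ ≡ k → degreeSum S + 2 ≤ 2 * suc k
      by-size zero #S′≡0 = ≤-reflexive (cong (_+ 2) (trans (degreeSum-remove Sy)
        (cong₂ (λ d e → d + (e + d)) (n≤0⇒n≡0 (subst (deg F S y ≤_) #S′≡0 (deg≤count-others Sy))) (degreeSum≡0 #S′≡0))))
      by-size (suc k′) #S′≡1+k′ = begin
        degreeSum S + 2
          ≡⟨ cong (_+ 2) (degreeSum-remove Sy) ⟩
        deg F S y + (degreeSum S′ + deg F S y) + 2
          ≡⟨ regroup (deg F S y) (degreeSum S′) ⟩
        (degreeSum S′ + 2) + (deg F S y + deg F S y)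
          ≤⟨ +-mono-≤ (degreeSum+2≤2*count k′ #S′≡1+k′) (+-mono-≤ dy≤1 dy≤1) ⟩
        2 * suc k′ + 2
          ≡⟨ double-suc (suc k′) ⟩
        2 * suc (suc k′)
          ∎
        where
        open ≤-Reasoning
        regroup : ∀ d e → d + (e + d) + 2 ≡ (e + 2) + (d + d)
        regroup = solve-∀
        double-suc : ∀ m → 2 * m + 2 ≡ 2 * suc m
        double-suc = solve-∀

  Branch Low : (Fin n → Bool) → Fin n → Bool
  Branch S v = S v ∧ (3 ≤ᵇ deg F S v)
  Low    S v = S v ∧ (deg F S v ≤ᵇ 1)

  Branch⁻ : ∀ {S v} → Branch S v ≡ true → S v ≡ true × 3 ≤ deg F S v
  Branch⁻ {S} {v} = ∧-≤ᵇ⁻ (S v) 3 (deg F S v)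

  Low⁻ : ∀ {S v} → Low S v ≡ true → S v ≡ true × deg F S v ≤ 1
  Low⁻ {S} {v} = ∧-≤ᵇ⁻ (S v) (deg F S v) 1

  deg≤1-count : (Fin n → Bool) → ℕ
  deg≤1-count S = count (Low S)

  nonisolated : (Fin n → Bool) → Fin n → Bool
  nonisolated S v = S v ∧ (1 ≤ᵇ deg F S v)

  deg-nonisolated : ∀ S {v} → S v ≡ true → deg F (nonisolated S) v ≡ deg F S v
  deg-nonisolated S {v} Sv = ≤-antisym
    (deg-mono F (nonisolated S) λ (Nu , _) → ∧-conicalˡ (S _) _ Nu)
    (deg-mono F S λ (Su , v~u) → ∧-≤ᵇ⁺ Su (neighbour⇒deg≥1 F S (Sv , ~-sym F S v~u)))

  -- Summed over the non-isolated vertices: 2 + [d ≥ 3] ≤ d + [d ≤ 1] for every degree d ≥ 1.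
  2*count+deg≥3-count≤degreeSum+deg≤1-count : ∀ S →
    count (nonisolated S) + count (nonisolated S) + deg≥3-count F S ≤ degreeSum (nonisolated S) + deg≤1-count S
  2*count+deg≥3-count≤degreeSum+deg≤1-count S = begin
    count N + count N + count B                             ≡⟨ cong₂ _+_ (count-+ N N) (count≡∑ B) ⟩
    ∑[ v < n ] (𝟙 (N v) + 𝟙 (N v)) + ∑[ v < n ] 𝟙 (B v)    ≡⟨ ∑-distrib-+ (λ v → 𝟙 (N v) + 𝟙 (N v)) (𝟙 ∘ B) ⟨
    ∑[ v < n ] (𝟙 (N v) + 𝟙 (N v) + 𝟙 (B v))               ≤⟨ sum-mono-≤ pointwise ⟩
    ∑[ v < n ] ((if N v then deg F N v else 0) + 𝟙 (L v))  ≡⟨ ∑-distrib-+ (λ v → if N v then deg F N v else 0) (𝟙 ∘ L) ⟩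
    degreeSum N + ∑[ v < n ] 𝟙 (L v)                       ≡⟨ cong (degreeSum N +_) (count≡∑ L) ⟨
    degreeSum N + count L                                   ∎
    where
    open ≤-Reasoning
    N = nonisolated S
    B = Branch S
    L = Low S
    by-degree : ∀ d → 𝟙 (1 ≤ᵇ d) + 𝟙 (1 ≤ᵇ d) + 𝟙 (3 ≤ᵇ d) ≤ (if 1 ≤ᵇ d then d else 0) + 𝟙 (d ≤ᵇ 1)
    by-degree 0                   = z≤n
    by-degree 1                   = ≤-refl
    by-degree 2                   = ≤-refl
    by-degree (suc (suc (suc d))) = s≤s (s≤s (s≤s z≤n))
    pointwise : ∀ v → 𝟙 (N v) + 𝟙 (N v) + 𝟙 (B v) ≤ (if N v then deg F N v else 0) + 𝟙 (L v)
    pointwise v with S v in Sv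
    ... | false = z≤n
    ... | true rewrite deg-nonisolated S Sv = by-degree (deg F S v)

  deg≥3-count+2≤deg≤1-count : ∀ S → 1 ≤ deg≥3-count F S → deg≥3-count F S + 2 ≤ deg≤1-count S
  deg≥3-count+2≤deg≤1-count S 1≤b = +-cancelˡ-≤ (degreeSum N) _ _ (begin
    degreeSum N + (b + 2)             ≡⟨ regroup (degreeSum N) b ⟩
    (degreeSum N + 2) + b             ≤⟨ +-monoˡ-≤ b (degreeSum+2≤2*count _ #N≡) ⟩
    2 * suc (count (remove x N)) + b  ≡⟨ cong (λ c → 2 * c + b) #N≡ ⟨
    2 * count N + b                   ≡⟨ cong (λ c → count N + c + b) (+-identityʳ (count N)) ⟩
    count N + count N + b             ≤⟨ 2*count+deg≥3-count≤degreeSum+deg≤1-count S ⟩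
    degreeSum N + deg≤1-count S       ∎)
    where
    open ≤-Reasoning
    N = nonisolated S
    b = deg≥3-count F S
    x = proj₁ (count-pos (Branch S) 1≤b)
    #N≡ : count N ≡ suc (count (remove x N))
    #N≡ = let Sx , 3≤dx = Branch⁻ (proj₂ (count-pos (Branch S) 1≤b)) in count-remove-true N (∧-≤ᵇ⁺ Sx (≤-trans (s≤s z≤n) 3≤dx))
    regroup : ∀ e b → e + (b + 2) ≡ (e + 2) + b
    regroup = solve-∀

  Branch∩Low≡∅ : ∀ S v → Branch S v ≡ true → Low S v ≢ true
  Branch∩Low≡∅ S v branch low = <⇒≱ (proj₂ (Branch⁻ branch)) (≤-trans (proj₂ (Low⁻ low)) (n≤1+n 1))

  deg≥3-count+deg≤1-count≤n : ∀ S → deg≥3-count F S + deg≤1-count S ≤ n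
  deg≥3-count+deg≤1-count≤n S = ≤-trans (count-disjoint-+ (Branch∩Low≡∅ S) (λ _ _ → refl) (λ _ _ → refl)) (count≤n _)

  -- A surviving branch vertex was a branch vertex, and a surviving vertex of degree ≤ 1 was one too.
  step-deg≥3-count+deg≤1-count : ∀ {S S′} → Step F S S′ → deg≥3-count F S′ + deg≤1-count S′ ≤ deg≥3-count F S
  step-deg≥3-count+deg≤1-count {S} {S′} step@(_ , _ , spec) =
    count-disjoint-+ (Branch∩Low≡∅ S′) branch-was-branch low-was-branch
    where
    S′⊆S : ∀ {u} → S′ u ≡ true → S u ≡ true
    S′⊆S {u} = proj₁ ∘ proj₁ (spec u)
    branch-was-branch : ∀ v → Branch S′ v ≡ true → Branch S v ≡ true
    branch-was-branch v branch′ = let S′v , 3≤d′v = Branch⁻ branch′ in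
      ∧-≤ᵇ⁺ (S′⊆S S′v) (≤-trans 3≤d′v (deg-mono F S′ (S′⊆S ∘ proj₁)))
    low-was-branch : ∀ v → Low S′ v ≡ true → Branch S v ≡ true
    low-was-branch v low′ = let S′v , d′v≤1 = Low⁻ low′ in
      ∧-≤ᵇ⁺ (S′⊆S S′v) (step-deg≤1⇒deg≥3 F S step S′v d′v≤1)

  deg≥3-count*2<n : 1 ≤ n → ∀ S → deg≥3-count F S * 2 < n
  deg≥3-count*2<n 1≤n S = halving-< (deg≥3-count+2≤deg≤1-count S) (deg≥3-count+deg≤1-count≤n S) 1≤n

  step-deg≥3-count-halves : ∀ {S S′} → Step F S S′ → deg≥3-count F S′ * 2 ≤ deg≥3-count F S
  step-deg≥3-count-halves {S′ = S′} step =
    halving-≤ (deg≥3-count+2≤deg≤1-count S′) (step-deg≥3-count+deg≤1-count step)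

  step-empties-subcubic : ∀ {S S′} → deg≥3-count F S ≡ 0 → Step F S S′ → ∀ v → S′ v ≡ false
  step-empties-subcubic {S} {S′} no-branch (_ , _ , spec) v = ¬-not λ S′v →
    let Sv , ¬pendant , _ = proj₁ (spec v) S′v in subcubic⇒on-maximal-pendant F S deg≤2 Sv ¬pendant
    where
    deg≤2 : ∀ w → S w ≡ true → deg F S w ≤ 2
    deg≤2 w Sw = ≮⇒≥ λ 2<dw → false≢true (trans (sym (count≡0⇒false (Branch S) no-branch w)) (∧-≤ᵇ⁺ Sw 2<dw))

lemma8 : ∀ (n : ℕ) (F : Forest n) (T : ℕ → Fin n → Bool) →
         1 ≤ n →
         (∀ v → T 1 v ≡ true) →
         (∀ i → 1 ≤ i → Step F (T i) (T (suc i))) →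
         (∀ i → 1 ≤ i → deg≥3-count F (T i) * 2 ^ i < n)
         × (2 ≤ n → ∀ v → T (⌈log₂ n ⌉ + 1) v ≡ false)
lemma8 n F T 1≤n _ steps = bound , vanishes
  where
  -- The bound does not need T 1 to be the whole forest.
  bound : ∀ i → 1 ≤ i → deg≥3-count F (T i) * 2 ^ i < n
  bound = halving-sequence (deg≥3-count F ∘ T) (deg≥3-count*2<n F 1≤n (T 1))
            λ i 1≤i → step-deg≥3-count-halves F (steps i 1≤i)

  vanishes : 2 ≤ n → ∀ v → T (⌈log₂ n ⌉ + 1) v ≡ false
  vanishes 2≤n v = subst (λ i → T i v ≡ false) (+-comm 1 k)
    (step-empties-subcubic F (*<≥⇒≡0 (bound k 1≤k) (n≤2^⌈log₂n⌉ n)) (steps k 1≤k) v)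
    where
    k = ⌈log₂ n ⌉
    1≤k = 1≤⌈log₂n⌉ 2≤n
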